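{- Let $\mathcal{M}$ be a fully-transitive 3-maniplex and let $T(\mathcal{M})$ be its symmetry type graph. Then either $\mathcal{M}$ is reflexible or $T(\mathcal{M})$ has an even number of vertices (i.e. $\mathrm{Aut}(\mathcal{M})$ has an even number of orbits on flags).
   Context: A 3-maniplex is given by a connected simple graph (flag graph), whose vertices are called flags, with a proper edge-colouring by colours $\{0,1,2,3\}$, each colour class a perfect matching, such that for colours $i,j$ with $|i-j|\ge2$ each component of the subgraph spanned by colours $i,j$ is a 4-cycle. Automorphisms are colour-preserving graph automorphisms; $\mathcal{M}$ is reflexible if $\mathrm{Aut}(\mathcal{M})$ is transitive on flags. An $i$-face is a connected component of the flag graph with the $i$-edges removed; $\mathcal{M}$ is fully-transitive if $\mathrm{Aut}(\mathcal{M})$ is transitive on $i$-faces for each $i\in\{0,1,2,3\}$. The symmetry type graph $T(\mathcal{M})$ is the pregraph whose vertices are the $\mathrm{Aut}(\mathcal{M})$-orbits of flags, with an edge of colour $a$ between distinct orbits $B,C$ iff some flag of $B$ is $a$-adjacent to a flag of $C$, and a semi-edge of colour $a$ at $B$ iff some flag of $B$ is $a$-adjacent to a flag of $B$. -}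

module Defs where

open import Data.Nat using (ℕ; _+_; _≤_)
open import Data.Fin using (Fin; toℕ)
open import Data.List using (List; []; _∷_)
open import Data.List.Relation.Unary.All using (All)
open import Data.Product using (Σ; _×_; ∃; _,_)
open import Data.Sum using (_⊎_)
open import Relation.Binary.PropositionalEquality using (_≡_; _≢_)

Colour : Set
Colour = Fin 4

FarApart : Colour → Colour → Set
FarApart i j = (toℕ i + 2 ≤ toℕ j) ⊎ (toℕ j + 2 ≤ toℕ i)

-- Flag graph given by the colour matchings: r i x is the unique flag
-- i-adjacent to x.
-- Apply a word of colours (a walk) starting at a flag.
walk : {F : Set} → (Colour → F → F) → List Colour → F → F
walk r []      x = x
walk r (c ∷ w) x = walk r w (r c x)

record Is3Maniplex (F : Set) (r : Colour → F → F) : Set where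
  field
    -- each colour class is a perfect matching (loopless, involutive)
    involutive : ∀ i x → r i (r i x) ≡ x
    loopless   : ∀ i x → r i x ≢ x
    -- simple graph with proper colouring: distinct colours give distinct neighbours
    simple     : ∀ i j x → i ≢ j → r i x ≢ r j x
    -- for |i-j| ≥ 2 each {i,j}-component is a 4-cycle
    -- (together with `simple` this is equivalent to r i r j = r j r i)
    commute    : ∀ i j x → FarApart i j → r i (r j x) ≡ r j (r i x)
    connected  : ∀ x y → ∃ λ (w : List Colour) → walk r w x ≡ y

record IsAut {F : Set} (r : Colour → F → F) (φ : F → F) : Set where
  field
    inv        : F → F
    inv-left   : ∀ x → inv (φ x) ≡ x
    inv-right  : ∀ x → φ (inv x) ≡ x
    preserves  : ∀ i x → φ (r i x) ≡ r i (φ x)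

SameOrbit : {F : Set} → (Colour → F → F) → F → F → Set
SameOrbit r x y = ∃ λ φ → IsAut r φ × φ x ≡ y

Reflexible : (F : Set) → (Colour → F → F) → Set
Reflexible F r = ∀ (x y : F) → SameOrbit r x y

SameFace : {F : Set} → (Colour → F → F) → Colour → F → F → Set
SameFace r i x y = ∃ λ (w : List Colour) → All (λ c → c ≢ i) w × walk r w x ≡ y

-- Fully transitive: for each i, Aut is transitive on i-faces
-- (the face of φ x is the image under φ of the face of x).
FullyTransitive : (F : Set) → (Colour → F → F) → Set
FullyTransitive F r = ∀ (i : Colour) (x y : F) →
  ∃ λ φ → IsAut r φ × SameFace r i (φ x) y

-- The vertex set of T(M) (the flag orbits) has exactly k elements:
-- a surjection from flags onto Fin k whose fibres are exactly the orbits.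
HasOrbitCount : (F : Set) → (Colour → F → F) → ℕ → Set
HasOrbitCount F r k =
  Σ (F → Fin k) λ o →
    (∀ (v : Fin k) → ∃ λ x → o x ≡ v) ×
    (∀ (x y : F) → (o x ≡ o y → SameOrbit r x y) × (SameOrbit r x y → o x ≡ o y))

module Submission where

open import Defs
open import Data.Nat using (ℕ; zero; suc; _+_; _*_; z≤n; s≤s)
open import Data.Nat.Divisibility using (_∣_; divides; _∣?_)
open import Data.Nat.Properties using (_<?_; <-asym; ≮⇒≥; ≤-antisym; +-identityʳ; *-comm; +-0-commutativeMonoid)
open import Data.Fin using (Fin; toℕ; _≟_)
open import Data.Fin.Properties using (toℕ-injective; any?)
open import Data.Fin.Permutation using (permutation)
open import Data.List using ([]; _∷_)
open import Data.List.Relation.Unary.All using (All; []; _∷_)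
open import Data.Product using (∃; _,_; proj₁; proj₂)
open import Data.Sum using (_⊎_; inj₁; inj₂)
open import Data.Empty using (⊥-elim)
open import Function using (_∘_)
open import Relation.Nullary using (Dec; yes; no; ¬_)
open import Relation.Binary.PropositionalEquality
open import Algebra.Properties.CommutativeMonoid.Sum +-0-commutativeMonoid
  using (sum; sum-permute; sum-cong-≗; ∑-distrib-+)

-- Flag orbits under a colour-preserving group are permuted by the colour
-- involutions, so the symmetry type graph is itself an action of the colours
-- on k points; full transitivity makes each of its i-faces connected.  If k is
-- odd, every involution on k points has a fixed point.  Colour 0 commutes with
-- all colours but 1, so a fixed point of 0 is carried along walks avoiding 1,
-- which reach every vertex: 0 acts trivially, and likewise 3.  A fixed point
-- of 1 is then fixed by every colour but 2, and walks avoiding 2 reach every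
-- vertex, so there is a single vertex, i.e. Aut(M) is flag-transitive.

indicator : {P : Set} → Dec P → ℕ
indicator (yes _) = 1
indicator (no _)  = 0

indicator-<-antisym : ∀ m n → m ≢ n → indicator (m <? n) + indicator (n <? m) ≡ 1
indicator-<-antisym m n m≢n with m <? n | n <? m
... | yes m<n | yes n<m = ⊥-elim (<-asym m<n n<m)
... | yes _   | no _    = refl
... | no _    | yes _   = refl
... | no m≮n  | no n≮m  = ⊥-elim (m≢n (≤-antisym (≮⇒≥ n≮m) (≮⇒≥ m≮n)))

sum-ones : ∀ n → sum {n} (λ _ → 1) ≡ n
sum-ones zero    = refl
sum-ones (suc n) = cong suc (sum-ones n)

-- Count the i with i < σ i: each pair {i , σ i} is counted exactly once, so
-- the count c satisfies c + c = n (reindexing along σ gives the second c).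
fixedPointFree-involution⇒even : ∀ {n} (σ : Fin n → Fin n) →
  (∀ i → σ (σ i) ≡ i) → (∀ i → σ i ≢ i) → 2 ∣ n
fixedPointFree-involution⇒even {n} σ σ-involutive σ-fixedPointFree =
  divides (sum below) n≡2c
  where
  below : Fin n → ℕ
  below i = indicator (toℕ i <? toℕ (σ i))

  pair-counted-once : ∀ i → below i + below (σ i) ≡ 1
  pair-counted-once i rewrite σ-involutive i =
    indicator-<-antisym (toℕ i) (toℕ (σ i)) (λ e → σ-fixedPointFree i (sym (toℕ-injective e)))

  n≡2c : n ≡ sum below * 2
  n≡2c = begin
    n                                   ≡⟨ sym (sum-ones n) ⟩
    sum {n} (λ _ → 1)                   ≡⟨ sym (sum-cong-≗ pair-counted-once) ⟩
    sum (λ i → below i + below (σ i))   ≡⟨ ∑-distrib-+ below (below ∘ σ) ⟩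
    sum below + sum (below ∘ σ)        ≡⟨ cong (sum below +_) (sym (sum-permute below π)) ⟩
    sum below + sum below               ≡⟨ cong (sum below +_) (sym (+-identityʳ (sum below))) ⟩
    2 * sum below                       ≡⟨ *-comm 2 (sum below) ⟩
    sum below * 2                       ∎
    where
    open ≡-Reasoning
    π = permutation σ σ σ-involutive σ-involutive

involution-fixedPoint : ∀ {n} → ¬ 2 ∣ n → (σ : Fin n → Fin n) →
  (∀ i → σ (σ i) ≡ i) → ∃ λ i → σ i ≡ i
involution-fixedPoint 2∤n σ σ-involutive with any? (λ i → σ i ≟ i)
... | yes fixed = fixed
... | no  none  = ⊥-elim (2∤n (fixedPointFree-involution⇒even σ σ-involutive (λ i e → none (i , e))))

pattern c₀ = Fin.zero
pattern c₁ = Fin.suc c₀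
pattern c₂ = Fin.suc c₁
pattern c₃ = Fin.suc c₂

FarCommuting : {V : Set} → (Colour → V → V) → Set
FarCommuting t = ∀ i j v → FarApart i j → t i (t j v) ≡ t j (t i v)

FaceConnected : {V : Set} → (Colour → V → V) → Set
FaceConnected t = ∀ i u v → SameFace t i u v

CommutesExcept : {V : Set} → (Colour → V → V) → Colour → Colour → Set
CommutesExcept t c i = ∀ d → d ≢ i → ∀ v → t c (t d v) ≡ t d (t c v)

module _ {V : Set} (t : Colour → V → V) where

  walk-fixes : ∀ {P : Colour → Set} {a} → (∀ {d} → P d → t d a ≡ a) →
    ∀ {w} → All P w → walk t w a ≡ a
  walk-fixes fixes []         = refl
  walk-fixes fixes (p ∷ ps) rewrite fixes p = walk-fixes fixes ps

  walk-preserves-fixed : ∀ {P : Colour → Set} {c} →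
    (∀ {d} → P d → ∀ v → t c (t d v) ≡ t d (t c v)) →
    ∀ {w} → All P w → ∀ {v} → t c v ≡ v → t c (walk t w v) ≡ walk t w v
  walk-preserves-fixed commutes []       fixed = fixed
  walk-preserves-fixed commutes (p ∷ ps) {v} fixed =
    walk-preserves-fixed commutes ps (trans (commutes p v) (cong (t _) fixed))

  fixedPoint-spreads : FaceConnected t → ∀ {c i} → CommutesExcept t c i →
    ∀ {a} → t c a ≡ a → ∀ u → t c u ≡ u
  fixedPoint-spreads connected {i = i} commutes {a} fixed u
    with connected i a u
  ... | w , avoids-i , refl = walk-preserves-fixed (commutes _) avoids-i fixed

  commutesExcept₁ : FarCommuting t → CommutesExcept t c₀ c₁
  commutesExcept₁ far c₀ _ v = refl
  commutesExcept₁ far c₁ 1≢1 v = ⊥-elim (1≢1 refl)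
  commutesExcept₁ far c₂ _ v = far c₀ c₂ v (inj₁ (s≤s (s≤s z≤n)))
  commutesExcept₁ far c₃ _ v = far c₀ c₃ v (inj₁ (s≤s (s≤s z≤n)))

  commutesExcept₂ : FarCommuting t → CommutesExcept t c₃ c₂
  commutesExcept₂ far c₀ _ v = far c₃ c₀ v (inj₂ (s≤s (s≤s z≤n)))
  commutesExcept₂ far c₁ _ v = far c₃ c₁ v (inj₂ (s≤s (s≤s (s≤s z≤n))))
  commutesExcept₂ far c₂ 2≢2 v = ⊥-elim (2≢2 refl)
  commutesExcept₂ far c₃ _ v = refl

  everyColourFixes⇒singleton : FarCommuting t → FaceConnected t →
    (∀ c → ∃ λ a → t c a ≡ a) → ∀ u v → u ≡ v
  everyColourFixes⇒singleton far connected fixedPoint u v =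
    trans (collapse u) (sym (collapse v))
    where
    a = proj₁ (fixedPoint c₁)

    fixedExcept₂ : ∀ {d} → d ≢ c₂ → t d a ≡ a
    fixedExcept₂ {c₀} _ = fixedPoint-spreads connected (commutesExcept₁ far)
                            (proj₂ (fixedPoint c₀)) a
    fixedExcept₂ {c₁} _ = proj₂ (fixedPoint c₁)
    fixedExcept₂ {c₂} 2≢2 = ⊥-elim (2≢2 refl)
    fixedExcept₂ {c₃} _ = fixedPoint-spreads connected (commutesExcept₂ far)
                            (proj₂ (fixedPoint c₃)) a

    collapse : ∀ x → x ≡ a
    collapse x with connected c₂ a x
    ... | w , avoids-2 , refl = walk-fixes fixedExcept₂ avoids-2

SameOrbit-respects-colour : ∀ {F : Set} {r : Colour → F → F} c {x y} →
  SameOrbit r x y → SameOrbit r (r c x) (r c y)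
SameOrbit-respects-colour c {x} (φ , φ-aut , refl) =
  φ , φ-aut , IsAut.preserves φ-aut c x

-- The symmetry type graph, with vertex set Fin k, realised as the colour
-- action r̄ c (o x) = o (r c x) induced by the orbit map o.
module SymmetryTypeGraph {F : Set} {r : Colour → F → F} (M : Is3Maniplex F r)
  {k : ℕ} (o : F → Fin k) (o-surjective : ∀ v → ∃ λ x → o x ≡ v)
  (o-fibres : ∀ x y → o x ≡ o y → SameOrbit r x y)
  (o-constant : ∀ x y → SameOrbit r x y → o x ≡ o y) where

  open Is3Maniplex M

  representative : Fin k → F
  representative v = proj₁ (o-surjective v)

  o-representative : ∀ v → o (representative v) ≡ v
  o-representative v = proj₂ (o-surjective v)

  r̄ : Colour → Fin k → Fin k
  r̄ c v = o (r c (representative v))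

  r̄-o : ∀ c x → r̄ c (o x) ≡ o (r c x)
  r̄-o c x = o-constant _ _ (SameOrbit-respects-colour c
              (o-fibres _ _ (o-representative (o x))))

  o-walk : ∀ w x → o (walk r w x) ≡ walk r̄ w (o x)
  o-walk []      x = refl
  o-walk (c ∷ w) x = trans (o-walk w (r c x)) (cong (walk r̄ w) (sym (r̄-o c x)))

  r̄-involutive : ∀ c v → r̄ c (r̄ c v) ≡ v
  r̄-involutive c v = begin
    r̄ c (o (r c x))   ≡⟨ r̄-o c (r c x) ⟩
    o (r c (r c x))   ≡⟨ cong o (involutive c x) ⟩
    o x               ≡⟨ o-representative v ⟩
    v                 ∎
    where open ≡-Reasoning
          x = representative v

  r̄-farCommuting : FarCommuting r̄
  r̄-farCommuting i j v far = begin
    r̄ i (o (r j x))   ≡⟨ r̄-o i (r j x) ⟩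
    o (r i (r j x))   ≡⟨ cong o (commute i j x far) ⟩
    o (r j (r i x))   ≡⟨ sym (r̄-o j (r i x)) ⟩
    r̄ j (o (r i x))   ∎
    where open ≡-Reasoning
          x = representative v

  r̄-faceConnected : FullyTransitive F r → FaceConnected r̄
  r̄-faceConnected fullyTransitive i u v
    with fullyTransitive i (representative u) (representative v)
  ... | φ , φ-aut , w , avoids-i , φx↝y = w , avoids-i , (begin
    walk r̄ w u                    ≡⟨ cong (walk r̄ w) (sym o-φx≡u) ⟩
    walk r̄ w (o (φ x))            ≡⟨ sym (o-walk w (φ x)) ⟩
    o (walk r w (φ x))            ≡⟨ cong o φx↝y ⟩
    o (representative v)          ≡⟨ o-representative v ⟩
    v                             ∎)
    where
    open ≡-Reasoning
    x = representative u
    o-φx≡u : o (φ x) ≡ u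
    o-φx≡u = trans (sym (o-constant x (φ x) (φ , φ-aut , refl))) (o-representative u)

theorem4p8 : (F : Set) (r : Colour → F → F) → Is3Maniplex F r →
    FullyTransitive F r → (k : ℕ) → HasOrbitCount F r k →
    Reflexible F r ⊎ 2 ∣ k
theorem4p8 F r M fullyTransitive k (o , o-surjective , o-fibres) with 2 ∣? k
... | yes 2∣k = inj₂ 2∣k
... | no  2∤k = inj₁ λ x y → proj₁ (o-fibres x y) (one-vertex (o x) (o y))
  where
  open SymmetryTypeGraph M o o-surjective
         (λ x y → proj₁ (o-fibres x y)) (λ x y → proj₂ (o-fibres x y))

  one-vertex : ∀ u v → u ≡ v
  one-vertex = everyColourFixes⇒singleton r̄ r̄-farCommuting
    (r̄-faceConnected fullyTransitive)
    (λ c → involution-fixedPoint 2∤k (r̄ c) (r̄-involutive c))
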